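{- Let $F\colon\mathbf{Set}\to\mathbf{Set}$ be a functor, let $\langle X_1,\xi_1\rangle$ and $\langle X_2,\xi_2\rangle$ be $F$-coalgebras, and let $R\subseteq X_1\times X_2$ be a relation with projections $\pi_i\colon R\to X_i$ and pushout $\langle P,p_1,p_2\rangle$. The following are equivalent: (1) $R$ is a precocongruence between $\langle X_1,\xi_1\rangle$ and $\langle X_2,\xi_2\rangle$; (2) $F(p_1)\circ\xi_1\circ\pi_1=F(p_2)\circ\xi_2\circ\pi_2$; (3) the relation $R_{12}=\{(\iota_1(x_1),\iota_2(x_2))\mid (x_1,x_2)\in R\}$ on $X_1+X_2$ is a precongruence on the disjoint union coalgebra $\langle X_1,\xi_1\rangle+\langle X_2,\xi_2\rangle$.
   Context: An $F$-coalgebra is $\langle X,\xi\rangle$ with $\xi\colon X\to F(X)$; $f$ is a coalgebra morphism if $F(f)\circ\xi_1=\xi_2\circ f$. The pushout of $R$ in $\mathbf{Set}$ is $P=(X_1+X_2)/\theta$ where $\theta$ is the smallest equivalence relation containing $R_{12}$, $\iota_i\colon X_i\to X_1+X_2$ are the canonical inclusions and $p_i=\varepsilon\circ\iota_i$ with $\varepsilon$ the quotient map. $R$ is a precocongruence if there is $\lambda\colon P\to F(P)$ making $p_1,p_2$ coalgebra morphisms into $\langle P,\lambda\rangle$. The disjoint union coalgebra has carrier $X_1+X_2$ and structure $F(\iota_i)\circ\xi_i$ on the summand $X_i$. An equivalence relation $Q$ on a coalgebra $\langle X,\xi\rangle$ is a congruence if there is a coalgebra structure on $X/Q$ making the quotient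 map a coalgebra morphism; a relation $R'\subseteq X\times X$ is a precongruence if the smallest equivalence relation containing $R'$ is a congruence. -}

module Defs where

open import Data.Product using (Σ; ∃; _×_; _,_)
open import Data.Sum using (_⊎_; inj₁; inj₂; [_,_])
open import Data.Empty using (⊥)
open import Function using (_∘_; id)
open import Relation.Binary.PropositionalEquality using (_≡_)
open import Relation.Binary.Construct.Closure.Equivalence using (EqClosure)

-- An endofunctor on Set (functor laws stated pointwise; no funext in Agda,
-- so we also require that F-map respects pointwise equality of functions).
record SetFunctor : Set₁ where
  field
    F      : Set → Set
    fmap   : {A B : Set} → (A → B) → F A → F B
    fmap-id : {A : Set} (x : F A) → fmap id x ≡ x
    fmap-∘  : {A B C : Set} (g : B → C) (f : A → B) (x : F A) →
              fmap (g ∘ f) x ≡ fmap g (fmap f x)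
    fmap-cong : {A B : Set} {f g : A → B} → (∀ a → f a ≡ g a) →
                (x : F A) → fmap f x ≡ fmap g x

module _ (Fun : SetFunctor) where
  open SetFunctor Fun

  IsCoalgMorphism : {X Y : Set} → (X → F X) → (Y → F Y) → (X → Y) → Set
  IsCoalgMorphism ξ ζ f = ∀ x → fmap f (ξ x) ≡ ζ (f x)

  sumCoalg : {X₁ X₂ : Set} → (X₁ → F X₁) → (X₂ → F X₂) → (X₁ ⊎ X₂ → F (X₁ ⊎ X₂))
  sumCoalg ξ₁ ξ₂ = [ fmap inj₁ ∘ ξ₁ , fmap inj₂ ∘ ξ₂ ]

-- q : X → Y presents Y as the quotient X / Q  (surjective, kernel exactly Q)
record IsQuotient {X Y : Set} (Q : X → X → Set) (q : X → Y) : Set where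
  field
    surj   : ∀ y → ∃ λ x → q x ≡ y
    kernel : ∀ x x′ → (q x ≡ q x′ → Q x x′) × (Q x x′ → q x ≡ q x′)

R₁₂ : {X₁ X₂ : Set} → (X₁ → X₂ → Set) → X₁ ⊎ X₂ → X₁ ⊎ X₂ → Set
R₁₂ R (inj₁ x₁) (inj₂ x₂) = R x₁ x₂
R₁₂ R (inj₁ _)  (inj₁ _)  = ⊥
R₁₂ R (inj₂ _)  _         = ⊥

θ : {X₁ X₂ : Set} → (X₁ → X₂ → Set) → X₁ ⊎ X₂ → X₁ ⊎ X₂ → Set
θ R = EqClosure (R₁₂ R)

module _ (Fun : SetFunctor) where
  open SetFunctor Fun

  IsCongruence : {X Y : Set} → (X → F X) → (Q : X → X → Set) →
                 (q : X → Y) → IsQuotient Q q → Set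
  IsCongruence {X} {Y} ξ Q q _ = Σ (Y → F Y) λ γ → IsCoalgMorphism Fun ξ γ q

  IsPrecongruence : {X Y : Set} → (X → F X) → (R′ : X → X → Set) →
                    (q : X → Y) → IsQuotient (EqClosure R′) q → Set
  IsPrecongruence ξ R′ q isq = IsCongruence ξ (EqClosure R′) q isq

  -- R is a precocongruence, pushout P = (X₁+X₂)/θ presented by ε
  IsPrecocongruence : {X₁ X₂ P : Set} → (X₁ → F X₁) → (X₂ → F X₂) →
                      (R : X₁ → X₂ → Set) → (ε : X₁ ⊎ X₂ → P) →
                      IsQuotient (θ R) ε → Set
  IsPrecocongruence {P = P} ξ₁ ξ₂ R ε _ =
    Σ (P → F P) λ λ′ → IsCoalgMorphism Fun ξ₁ λ′ (ε ∘ inj₁)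
                     × IsCoalgMorphism Fun ξ₂ λ′ (ε ∘ inj₂)

module Submission where

-- Two general facts carry the proof.  First, a map out of a quotient X/Q is
-- the same as a map out of X constant on Q-classes, and a map that respects
-- a relation respects its equivalence closure; so (2) lets the copairing
-- [F(ε∘inj₁)∘ξ₁ , F(ε∘inj₂)∘ξ₂] descend to a structure λ on P, giving (1).
-- Conversely, the structure of (1) is a function of the point of P, and
-- ε(inj₁ x₁) = ε(inj₂ x₂) for related points, giving (2).  Second, a map out
-- of the disjoint union coalgebra is a coalgebra morphism exactly when both
-- of its restrictions along inj₁, inj₂ are; this is (1) ⇔ (3), since (3)
-- asks for a structure on P making ε itself a morphism.

open import Defs
open import Data.Product using (Σ; _×_; _,_; proj₁; proj₂)
open import Data.Sum using (inj₁; inj₂; _⊎_; [_,_])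
open import Function using (_∘_; _⇔_; mk⇔; Equivalence)
open import Relation.Binary.PropositionalEquality
  using (_≡_; sym; trans; cong; isEquivalence; module ≡-Reasoning)
open import Relation.Binary.Construct.Closure.Equivalence
  using (EqClosure; gfold; return)

respects-closure : {X B : Set} (R : X → X → Set) (g : X → B) →
  (∀ x y → R x y → g x ≡ g y) → ∀ {x y} → EqClosure R x y → g x ≡ g y
respects-closure R g g-resp = gfold {R = R} isEquivalence g (g-resp _ _)

module _ {X Y : Set} {Q : X → X → Set} {q : X → Y} (isq : IsQuotient Q q) where
  open IsQuotient isq

  quotient-identifies : ∀ {x x′} → Q x x′ → q x ≡ q x′
  quotient-identifies {x} {x′} = proj₂ (kernel x x′)

  -- Universal property of the quotient: a map constant on Q-classes factors
  -- through q (choosing a representative of each class is harmless).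
  factor-through-quotient : {B : Set} (g : X → B) → (∀ {x x′} → Q x x′ → g x ≡ g x′) →
           Σ (Y → B) λ h → ∀ x → h (q x) ≡ g x
  factor-through-quotient {B} g g-resp = h , h∘q≡g
    where
      h : Y → B
      h y = g (proj₁ (surj y))

      h∘q≡g : ∀ x → h (q x) ≡ g x
      h∘q≡g x = g-resp (proj₁ (kernel (proj₁ (surj (q x))) x) (proj₂ (surj (q x))))

module _ (Fun : SetFunctor) where
  open SetFunctor Fun

  sum-morphism : {X₁ X₂ Y : Set} (ξ₁ : X₁ → F X₁) (ξ₂ : X₂ → F X₂)
    (γ : Y → F Y) (f : X₁ ⊎ X₂ → Y) →
    IsCoalgMorphism Fun (sumCoalg Fun ξ₁ ξ₂) γ f
      ⇔ (IsCoalgMorphism Fun ξ₁ γ (f ∘ inj₁) × IsCoalgMorphism Fun ξ₂ γ (f ∘ inj₂))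
  sum-morphism ξ₁ ξ₂ γ f = mk⇔ restrict copair
    where
      restrict : IsCoalgMorphism Fun (sumCoalg Fun ξ₁ ξ₂) γ f →
        IsCoalgMorphism Fun ξ₁ γ (f ∘ inj₁) × IsCoalgMorphism Fun ξ₂ γ (f ∘ inj₂)
      restrict m = (λ x₁ → trans (fmap-∘ f inj₁ (ξ₁ x₁)) (m (inj₁ x₁)))
                 , (λ x₂ → trans (fmap-∘ f inj₂ (ξ₂ x₂)) (m (inj₂ x₂)))

      copair : IsCoalgMorphism Fun ξ₁ γ (f ∘ inj₁) × IsCoalgMorphism Fun ξ₂ γ (f ∘ inj₂) →
        IsCoalgMorphism Fun (sumCoalg Fun ξ₁ ξ₂) γ f
      copair (m₁ , m₂) (inj₁ x₁) = trans (sym (fmap-∘ f inj₁ (ξ₁ x₁))) (m₁ x₁)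
      copair (m₁ , m₂) (inj₂ x₂) = trans (sym (fmap-∘ f inj₂ (ξ₂ x₂))) (m₂ x₂)

  module _ {X₁ X₂ : Set} (ξ₁ : X₁ → F X₁) (ξ₂ : X₂ → F X₂) (R : X₁ → X₂ → Set)
           {P : Set} (ε : X₁ ⊎ X₂ → P) (isq : IsQuotient (θ R) ε) where

    Compatible : Set
    Compatible = ∀ (x₁ : X₁) (x₂ : X₂) → R x₁ x₂ →
                 fmap (ε ∘ inj₁) (ξ₁ x₁) ≡ fmap (ε ∘ inj₂) (ξ₂ x₂)

    -- The transition structure a precocongruence structure on P must extend.
    pushed : X₁ ⊎ X₂ → F P
    pushed = [ fmap (ε ∘ inj₁) ∘ ξ₁ , fmap (ε ∘ inj₂) ∘ ξ₂ ]

    pushed-respects-θ : Compatible → ∀ {x y} → θ R x y → pushed x ≡ pushed y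
    pushed-respects-θ compat = respects-closure (R₁₂ R) pushed on-R₁₂
      where
        on-R₁₂ : ∀ x y → R₁₂ R x y → pushed x ≡ pushed y
        on-R₁₂ (inj₁ x₁) (inj₂ x₂) r = compat x₁ x₂ r

    -- (1) ⇒ (2): related points have the same image in P, hence the same
    -- λ-transition, which both morphism squares compute.
    precocongruence⇒compatible : IsPrecocongruence Fun ξ₁ ξ₂ R ε isq → Compatible
    precocongruence⇒compatible (λ′ , m₁ , m₂) x₁ x₂ r = begin
      fmap (ε ∘ inj₁) (ξ₁ x₁)  ≡⟨ m₁ x₁ ⟩
      λ′ (ε (inj₁ x₁))         ≡⟨ cong λ′ (quotient-identifies isq (return r)) ⟩
      λ′ (ε (inj₂ x₂))         ≡⟨ sym (m₂ x₂) ⟩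
      fmap (ε ∘ inj₂) (ξ₂ x₂)  ∎
      where open ≡-Reasoning

    -- (2) ⇒ (1): `pushed` descends along ε to the required structure on P.
    compatible⇒precocongruence : Compatible → IsPrecocongruence Fun ξ₁ ξ₂ R ε isq
    compatible⇒precocongruence compat =
      λ′ , (λ x₁ → sym (λ′∘ε≡pushed (inj₁ x₁))) , (λ x₂ → sym (λ′∘ε≡pushed (inj₂ x₂)))
      where
        descended : Σ (P → F P) λ h → ∀ x → h (ε x) ≡ pushed x
        descended = factor-through-quotient isq pushed (pushed-respects-θ compat)

        λ′ : P → F P
        λ′ = proj₁ descended

        λ′∘ε≡pushed : ∀ x → λ′ (ε x) ≡ pushed x
        λ′∘ε≡pushed = proj₂ descended

    -- (1) ⇔ (3): both ask for a structure on P, for the two injections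
    -- separately resp. for ε on the disjoint union.
    precocongruence⇔precongruence :
      IsPrecocongruence Fun ξ₁ ξ₂ R ε isq
        ⇔ IsPrecongruence Fun (sumCoalg Fun ξ₁ ξ₂) (R₁₂ R) ε isq
    precocongruence⇔precongruence = mk⇔
      (λ (λ′ , ms) → λ′ , Equivalence.from (sum-morphism ξ₁ ξ₂ λ′ ε) ms)
      (λ (λ′ , m) → λ′ , Equivalence.to (sum-morphism ξ₁ ξ₂ λ′ ε) m)

lemma3p6 : (Fun : SetFunctor) → let open SetFunctor Fun in
    {X₁ X₂ : Set} (ξ₁ : X₁ → F X₁) (ξ₂ : X₂ → F X₂)
    (R : X₁ → X₂ → Set)
    {P : Set} (ε : X₁ ⊎ X₂ → P) (isq : IsQuotient (θ R) ε) →
    (IsPrecocongruence Fun ξ₁ ξ₂ R ε isq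
      ⇔ (∀ (x₁ : X₁) (x₂ : X₂) → R x₁ x₂ → fmap (ε ∘ inj₁) (ξ₁ x₁) ≡ fmap (ε ∘ inj₂) (ξ₂ x₂)))
    × (IsPrecocongruence Fun ξ₁ ξ₂ R ε isq
      ⇔ IsPrecongruence Fun (sumCoalg Fun ξ₁ ξ₂) (R₁₂ R) ε isq)
lemma3p6 Fun ξ₁ ξ₂ R ε isq =
    mk⇔ (precocongruence⇒compatible Fun ξ₁ ξ₂ R ε isq)
        (compatible⇒precocongruence Fun ξ₁ ξ₂ R ε isq)
  , precocongruence⇔precongruence Fun ξ₁ ξ₂ R ε isq
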